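{- Let $w\in\widetilde{S}_n$, fix $\beta\in\mathbb{Z}$ with $w_i<w_\beta$ for all $i<\beta$, and let $a_1<\dots<a_r$ be the indices of the left-to-right maxima of the window $w_\beta,w_{\beta+1},\dots,w_{\beta+n-1}$. If $r\ge2$ and there exists $1\le i\le r-1$ such that $w_b>w_{a_i}$ for all $a_{i+1}\le b<a_{i+1}+n$, then $w$ lies in a proper parabolic subgroup of $\widetilde{S}_n$. Equivalently, if $w$ lies in no proper parabolic subgroup, then either $r=1$, or for every $1\le i\le r-1$ there exists $a_{i+1}<j<a_{i+1}+n$ with $w_j<w_{a_i}$.
   Context: $\widetilde{S}_n$ is the set of bijections $w:\mathbb{Z}\to\mathbb{Z}$ with $w(i+n)=w(i)+n$ and $\sum_{i=1}^n w(i)=\binom{n+1}{2}$; write $w_i=w(i)$. It is a Coxeter group with generators $S=\{s_0,\dots,s_{n-1}\}$, $s_i$ interchanging $i+kn$ and $i+1+kn$ for all $k$; a proper parabolic subgroup is a subgroup generated by some $J\subsetneq S$. The left-to-right maxima indices of a finite sequence $t_1,\dots,t_m$ are the indices $c$ with $t_c>t_e$ for all $e<c$ (the first index always included); here $a_1=\beta$. -}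

module Defs where

open import Data.Nat as ℕ using (ℕ; NonZero)
open import Data.Integer using (ℤ; +_; _+_; _-_; _<_; _≤_; _>_)
open import Data.Integer.DivMod using (_%ℕ_)
open import Data.Fin using (Fin; toℕ)
open import Data.Fin.Subset using (Subset; _∈_; _∉_)
open import Data.List using (List; []; _∷_; foldr; map; sum; upTo)
open import Data.List.Relation.Unary.All using (All)
open import Data.Product using (Σ; ∃; _×_; _,_)
open import Function using (_∘_; id)
open import Function.Definitions using (Bijective)
open import Relation.Binary.PropositionalEquality using (_≡_)
open import Relation.Nullary using (¬_; yes; no)

windowSum : (ℤ → ℤ) → ℕ → ℤ
windowSum w n = foldr _+_ (+ 0) (map (λ k → w (+ (ℕ.suc k))) (upTo n))

record IsAffinePerm (n : ℕ) (w : ℤ → ℤ) : Set where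
  field
    bijective : Bijective _≡_ _≡_ w
    periodic  : ∀ i → w (i + + n) ≡ w i + + n
    windowSum≡ : windowSum w n ≡ + (n ℕ.* ℕ.suc n ℕ./ 2)

-- The Coxeter generator s_i (i ∈ {0,…,n-1}): swaps i+kn and i+1+kn for all k.
gen : (n : ℕ) .{{_ : NonZero n}} → Fin n → ℤ → ℤ
gen n i x with (x %ℕ n) ℕ.≟ toℕ i
... | yes _ = x + + 1
... | no _ with (x %ℕ n) ℕ.≟ ((toℕ i ℕ.+ 1) ℕ.% n)
...   | yes _ = x - + 1
...   | no _ = x

evalWord : (n : ℕ) .{{_ : NonZero n}} → List (Fin n) → ℤ → ℤ
evalWord n = foldr (λ j f → gen n j ∘ f) id

-- w lies in the parabolic subgroup W_J generated by {s_j : j ∈ J}.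
-- Since each s_j is an involution, W_J is the set of products of generators in J.
InParabolic : (n : ℕ) .{{_ : NonZero n}} → Subset n → (ℤ → ℤ) → Set
InParabolic n J w =
  Σ (List (Fin n)) λ word → All (_∈ J) word × (∀ x → w x ≡ evalWord n word x)

InProperParabolic : (n : ℕ) .{{_ : NonZero n}} → (ℤ → ℤ) → Set
InProperParabolic n w =
  Σ (Subset n) λ J → (∃ λ j → j ∉ J) × InParabolic n J w

IsLRMax : (n : ℕ) → (ℤ → ℤ) → ℤ → ℤ → Set
IsLRMax n w β c = β ≤ c × c < β + + n × (∀ e → β ≤ e → e < c → w e < w c)

ConsecLRMax : (n : ℕ) → (ℤ → ℤ) → ℤ → ℤ → ℤ → Set
ConsecLRMax n w β c d =
  IsLRMax n w β c × IsLRMax n w β d × c < d ×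
  (∀ e → c < e → e < d → ¬ IsLRMax n w β e)

-- Every x < d = a_{i+1} has w x ≤ w c for c = a_i, for otherwise a left-to-right maximum
-- would lie between c and d.  With periodicity and the hypothesis on [d, d + n), w maps that
-- window injectively into [w c + 1, w c + n].  Shifted by d - (w c + 1), it becomes a periodic
-- permutation of the window, which selection sort writes as a word in s_d, …, s_{d+n-2}; such
-- words do not change the window sum, so the sum condition on w forces the shift to be 0.
-- Hence w itself is a word avoiding s_{d-1}.
module Submission where

open import Defs
open import Algebra.Bundles using (AbelianGroup)
open import Data.Empty using (⊥-elim)
open import Data.Fin using (Fin; toℕ; fromℕ<)
import Data.Fin.Properties as Finₚ
open import Data.Fin.Subset using (_∈_; ∁; ⁅_⁆)
import Data.Fin.Subset.Properties as Subsetₚ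
open import Data.Integer as ℤ
  using (ℤ; +_; -[1+_]; _+_; _-_; _*_; -_; _<_; _≤_; _>_; ∣_∣; 0ℤ; 1ℤ; -1ℤ; +≤+; +<+; _%ℕ_; _/ℕ_)
import Data.Integer.Properties as ℤₚ
open import Data.Integer.DivMod using (a≡a%ℕn+[a/ℕn]*n; n%ℕd<d)
open import Data.Integer.Tactic.RingSolver using (solve-∀)
open import Data.List using (List; []; _∷_; _++_; foldr; map; applyUpTo)
open import Data.List.Relation.Unary.All using (All; []; _∷_)
import Data.List.Relation.Unary.All.Properties as Allₚ
open import Data.Nat as ℕ using (ℕ; NonZero; zero; suc; z≤n; s≤s)
import Data.Nat.Properties as ℕₚ
import Data.Nat.DivMod as ℕ
open import Data.Nat.Divisibility using (n∣m*n)
open import Data.Nat.Induction using (<-wellFounded)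
import Data.Nat.Tactic.RingSolver as ℕSolver
open import Data.Product using (Σ; _×_; _,_; proj₁; proj₂)
open import Function using (_∘_; id)
open import Function.Definitions using (Injective)
open import Induction.WellFounded using (module All)
import Relation.Binary.Construct.On as On
open import Relation.Binary.Definitions using (tri<; tri≈; tri>)
open import Relation.Binary.PropositionalEquality
open import Relation.Nullary using (¬_; yes; no)

open import Algebra.Properties.Group (AbelianGroup.group ℤₚ.+-0-abelianGroup)
  using (∙-cancelˡ; ∙-cancelʳ)

+-cancelˡ-≤ : ∀ a {b c} → a + b ≤ a + c → b ≤ c
+-cancelˡ-≤ a {b} {c} a+b≤a+c =
  subst₂ _≤_ (cancel a b) (cancel a c) (ℤₚ.+-monoʳ-≤ (- a) a+b≤a+c)
  where
    cancel : ∀ a b → - a + (a + b) ≡ b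
    cancel = solve-∀

i<i+1 : ∀ x → x < x + 1ℤ
i<i+1 x = ℤₚ.suc[i]≤j⇒i<j (ℤₚ.≤-reflexive (ℤₚ.+-comm 1ℤ x))

i≤j⇒i≤j+1 : ∀ {i j} → i ≤ j → i ≤ j + 1ℤ
i≤j⇒i≤j+1 {j = j} i≤j = ℤₚ.≤-trans i≤j (ℤₚ.<⇒≤ (i<i+1 j))

i+1≤i+suc : ∀ i l → i + 1ℤ ≤ i + + suc l
i+1≤i+suc i l = ℤₚ.+-monoʳ-≤ i (+≤+ (s≤s z≤n))

+1-1 : ∀ x → x + 1ℤ - 1ℤ ≡ x
+1-1 = solve-∀

-1+1 : ∀ x → x - 1ℤ + 1ℤ ≡ x
-1+1 = solve-∀

swap-+ : ∀ x a b → x + a + b ≡ x + b + a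
swap-+ = solve-∀

≤⇒≡+ : ∀ {a b} → a ≤ b → Σ ℕ λ k → b ≡ a + + k
≤⇒≡+ {a} {b} a≤b =
  ∣ a - b ∣ , trans (sym (add-diff a b)) (cong (λ s → a + s) (sym (ℤₚ.∣-∣-≤ a≤b)))
  where
    add-diff : ∀ a b → a + (b - a) ≡ b
    add-diff = solve-∀

InWindow : ℕ → ℤ → ℤ → Set
InWindow n d x = d ≤ x × x < d + + n

window-+n≰ : ∀ {n d a b} → InWindow n d a → InWindow n d b → ¬ (a + + n ≤ b)
window-+n≰ {n} (d≤a , _) (_ , b<d+n) a+n≤b =
  ℤₚ.<-irrefl refl (ℤₚ.<-≤-trans b<d+n (ℤₚ.≤-trans (ℤₚ.+-monoˡ-≤ (+ n) d≤a) a+n≤b))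

Periodic : ℕ → (ℤ → ℤ) → Set
Periodic n f = ∀ x → f (x + + n) ≡ f x + + n

periodic-∘ : ∀ {n f g} → Periodic n f → Periodic n g → Periodic n (f ∘ g)
periodic-∘ {f = f} {g} f-per g-per x = trans (cong f (g-per x)) (f-per (g x))

periodic-+* : ∀ {n f} → Periodic n f → ∀ m x → f (x + + m * + n) ≡ f x + + m * + n
periodic-+* {n} {f} f-per zero x =
  trans (cong f (ℤₚ.+-identityʳ x)) (sym (ℤₚ.+-identityʳ (f x)))
periodic-+* {n} {f} f-per (suc m) x = begin
  f (x + + suc m * + n)      ≡⟨ cong f (unfold x (+ m) (+ n)) ⟩
  f (x + + m * + n + + n)    ≡⟨ f-per (x + + m * + n) ⟩
  f (x + + m * + n) + + n    ≡⟨ cong (_+ + n) (periodic-+* {n} {f} f-per m x) ⟩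
  f x + + m * + n + + n      ≡⟨ unfold (f x) (+ m) (+ n) ⟨
  f x + + suc m * + n        ∎
  where
    open ≡-Reasoning
    unfold : ∀ x a b → x + (1ℤ + a) * b ≡ x + a * b + b
    unfold = solve-∀

periodic-* : ∀ {n f} → Periodic n f → ∀ q x → f (x + q * + n) ≡ f x + q * + n
periodic-* {n} {f} f-per (+ m) x = periodic-+* {n} {f} f-per m x
periodic-* {n} {f} f-per -[1+ m ] x = ∙-cancelʳ (+ suc m * + n) _ _ (begin
  f (x + -[1+ m ] * + n) + + suc m * + n   ≡⟨ periodic-+* {n} {f} f-per (suc m) _ ⟨
  f (x + -[1+ m ] * + n + + suc m * + n)   ≡⟨ cong f (cancel x (+ suc m) (+ n)) ⟩
  f x                                      ≡⟨ cancel (f x) (+ suc m) (+ n) ⟨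
  f x + -[1+ m ] * + n + + suc m * + n     ∎)
  where
    open ≡-Reasoning
    cancel : ∀ x a b → x + (- a) * b + a * b ≡ x
    cancel = solve-∀

sumUpTo : (ℕ → ℤ) → ℕ → ℤ
sumUpTo F zero    = 0ℤ
sumUpTo F (suc m) = F 0 + sumUpTo (F ∘ suc) m

foldr-map-applyUpTo : ∀ (F : ℕ → ℤ) g m → foldr _+_ 0ℤ (map F (applyUpTo g m)) ≡ sumUpTo (F ∘ g) m
foldr-map-applyUpTo F g zero    = refl
foldr-map-applyUpTo F g (suc m) = cong (_+_ (F (g 0))) (foldr-map-applyUpTo F (g ∘ suc) m)

sumUpTo-cong : ∀ {F G} m → (∀ k → k ℕ.< m → F k ≡ G k) → sumUpTo F m ≡ sumUpTo G m
sumUpTo-cong zero    _  = refl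
sumUpTo-cong (suc m) eq = cong₂ _+_ (eq 0 (s≤s z≤n)) (sumUpTo-cong m (λ k k<m → eq (suc k) (s≤s k<m)))

sumUpTo-snoc : ∀ F m → sumUpTo F (suc m) ≡ sumUpTo F m + F m
sumUpTo-snoc F zero    = ℤₚ.+-comm (F 0) 0ℤ
sumUpTo-snoc F (suc m) = trans (cong (_+_ (F 0)) (sumUpTo-snoc (F ∘ suc) m))
                               (sym (ℤₚ.+-assoc (F 0) (sumUpTo (F ∘ suc) m) (F (suc m))))

sumUpTo-+const : ∀ F c m → sumUpTo (λ k → F k + c) m ≡ sumUpTo F m + + m * c
sumUpTo-+const F c zero    = sym (trans (ℤₚ.+-identityˡ _) (ℤₚ.*-zeroˡ c))
sumUpTo-+const F c (suc m) = trans (cong (_+_ (F 0 + c)) (sumUpTo-+const (F ∘ suc) c m))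
                                   (regroup (F 0) c (sumUpTo (F ∘ suc) m) (+ m))
  where
    regroup : ∀ a c s m → a + c + (s + m * c) ≡ a + s + (1ℤ + m) * c
    regroup = solve-∀

sumUpTo-except : ∀ {F G} m b → b ℕ.< m → (∀ k → k ℕ.< m → k ≢ b → G k ≡ F k) →
                 sumUpTo G m + F b ≡ sumUpTo F m + G b
sumUpTo-except {F} {G} (suc m) zero _ same = begin
  G 0 + sumUpTo (G ∘ suc) m + F 0  ≡⟨ cong (λ s → G 0 + s + F 0) tails ⟩
  G 0 + sumUpTo (F ∘ suc) m + F 0  ≡⟨ exchange (G 0) _ (F 0) ⟩
  F 0 + sumUpTo (F ∘ suc) m + G 0  ∎
  where
    open ≡-Reasoning
    tails = sumUpTo-cong m (λ k k<m → same (suc k) (s≤s k<m) λ ())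
    exchange : ∀ a s b → a + s + b ≡ b + s + a
    exchange = solve-∀
sumUpTo-except {F} {G} (suc m) (suc b) (s≤s b<m) same = begin
  G 0 + sumUpTo (G ∘ suc) m + F (suc b)    ≡⟨ ℤₚ.+-assoc (G 0) _ _ ⟩
  G 0 + (sumUpTo (G ∘ suc) m + F (suc b))  ≡⟨ cong₂ _+_ (same 0 (s≤s z≤n) λ ()) tails ⟩
  F 0 + (sumUpTo (F ∘ suc) m + G (suc b))  ≡⟨ ℤₚ.+-assoc (F 0) _ _ ⟨
  F 0 + sumUpTo (F ∘ suc) m + G (suc b)    ∎
  where
    open ≡-Reasoning
    tails = sumUpTo-except m b b<m (λ k k<m k≢b → same (suc k) (s≤s k<m) (k≢b ∘ ℕₚ.suc-injective))

sumUpTo-exchange : ∀ {F G} m a b → a ℕ.< b → b ℕ.< m →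
                   (∀ k → k ℕ.< m → k ≢ a → k ≢ b → G k ≡ F k) →
                   G a + G b ≡ F a + F b → sumUpTo G m ≡ sumUpTo F m
sumUpTo-exchange {F} {G} (suc m) zero (suc b) _ (s≤s b<m) same swapped =
  ∙-cancelʳ (F (suc b)) _ _ (begin
    G 0 + sG + F (suc b)      ≡⟨ ℤₚ.+-assoc (G 0) sG _ ⟩
    G 0 + (sG + F (suc b))    ≡⟨ cong (_+_ (G 0)) tails ⟩
    G 0 + (sF + G (suc b))    ≡⟨ exchange (G 0) sF _ ⟩
    sF + (G 0 + G (suc b))    ≡⟨ cong (_+_ sF) swapped ⟩
    sF + (F 0 + F (suc b))    ≡⟨ exchange (F 0) sF _ ⟨
    F 0 + (sF + F (suc b))    ≡⟨ ℤₚ.+-assoc (F 0) sF _ ⟨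
    F 0 + sF + F (suc b)      ∎)
  where
    open ≡-Reasoning
    sG = sumUpTo (G ∘ suc) m
    sF = sumUpTo (F ∘ suc) m
    tails = sumUpTo-except m b b<m
      (λ k k<m k≢b → same (suc k) (s≤s k<m) (λ ()) (k≢b ∘ ℕₚ.suc-injective))
    exchange : ∀ a s b → a + (s + b) ≡ s + (a + b)
    exchange = solve-∀
sumUpTo-exchange {F} {G} (suc m) (suc a) (suc b) (s≤s a<b) (s≤s b<m) same swapped =
  cong₂ _+_ (same 0 (s≤s z≤n) (λ ()) (λ ()))
    (sumUpTo-exchange m a b a<b b<m
      (λ k k<m k≢a k≢b →
        same (suc k) (s≤s k<m) (k≢a ∘ ℕₚ.suc-injective) (k≢b ∘ ℕₚ.suc-injective))
      swapped)

sumUpTo-suc : ∀ m → sumUpTo (λ k → + suc k) m ≡ + (m ℕ.* suc m ℕ./ 2)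
sumUpTo-suc zero    = refl
sumUpTo-suc (suc m) = begin
  sumUpTo (λ k → + suc k) (suc m)        ≡⟨ sumUpTo-snoc (λ k → + suc k) m ⟩
  sumUpTo (λ k → + suc k) m + + suc m    ≡⟨ cong (_+ + suc m) (sumUpTo-suc m) ⟩
  + (m ℕ.* suc m ℕ./ 2 ℕ.+ suc m)        ≡⟨ cong +_ halve ⟨
  + (suc m ℕ.* suc (suc m) ℕ./ 2)        ∎
  where
    open ≡-Reasoning
    expand : ∀ m → suc m ℕ.* suc (suc m) ≡ m ℕ.* suc m ℕ.+ suc m ℕ.* 2
    expand = ℕSolver.solve-∀
    t = m ℕ.* suc m
    halve : suc m ℕ.* suc (suc m) ℕ./ 2 ≡ t ℕ./ 2 ℕ.+ suc m
    halve = begin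
      suc m ℕ.* suc (suc m) ℕ./ 2      ≡⟨ cong (ℕ._/ 2) (expand m) ⟩
      (t ℕ.+ suc m ℕ.* 2) ℕ./ 2        ≡⟨ ℕ.+-distrib-/-∣ʳ t (n∣m*n (suc m)) ⟩
      t ℕ./ 2 ℕ.+ suc m ℕ.* 2 ℕ./ 2    ≡⟨ cong (t ℕ./ 2 ℕ.+_) (ℕ.m*n/n≡m (suc m) 2) ⟩
      t ℕ./ 2 ℕ.+ suc m                ∎

windowSum-sumUpTo : ∀ f n → windowSum f n ≡ sumUpTo (λ k → f (+ suc k)) n
windowSum-sumUpTo f n = foldr-map-applyUpTo (λ k → f (+ suc k)) id n

windowSum-cong : ∀ {f g} n → (∀ x → f x ≡ g x) → windowSum f n ≡ windowSum g n
windowSum-cong {f} {g} n f≗g = begin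
  windowSum f n                      ≡⟨ windowSum-sumUpTo f n ⟩
  sumUpTo (λ k → f (+ suc k)) n      ≡⟨ sumUpTo-cong n (λ k _ → f≗g (+ suc k)) ⟩
  sumUpTo (λ k → g (+ suc k)) n      ≡⟨ windowSum-sumUpTo g n ⟨
  windowSum g n                      ∎
  where open ≡-Reasoning

windowSum-+const : ∀ f c n → windowSum (λ x → f x + c) n ≡ windowSum f n + + n * c
windowSum-+const f c n = begin
  windowSum (λ x → f x + c) n              ≡⟨ windowSum-sumUpTo (λ x → f x + c) n ⟩
  sumUpTo (λ k → f (+ suc k) + c) n        ≡⟨ sumUpTo-+const _ c n ⟩
  sumUpTo (λ k → f (+ suc k)) n + + n * c  ≡⟨ cong (_+ + n * c) (windowSum-sumUpTo f n) ⟨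
  windowSum f n + + n * c                  ∎
  where open ≡-Reasoning

windowSum-id : ∀ n → windowSum id n ≡ + (n ℕ.* suc n ℕ./ 2)
windowSum-id n = trans (windowSum-sumUpTo id n) (sumUpTo-suc n)

module Residues (n : ℕ) .{{_ : NonZero n}} where

  decompose : ∀ x → x ≡ + (x %ℕ n) + x /ℕ n * + n
  decompose x = a≡a%ℕn+[a/ℕn]*n x n

  *-suc-≤ : ∀ {q q′} → q < q′ → q * + n + + n ≤ q′ * + n
  *-suc-≤ {q} {q′} q<q′ = begin
    q * + n + + n    ≡⟨ ℤₚ.+-comm (q * + n) (+ n) ⟩
    + n + q * + n    ≡⟨ ℤₚ.suc-* q (+ n) ⟨
    ℤ.suc q * + n    ≤⟨ ℤₚ.*-monoʳ-≤-nonNeg (+ n) (ℤₚ.i<j⇒suc[i]≤j q<q′) ⟩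
    q′ * + n         ∎
    where open ℤₚ.≤-Reasoning

  decompose-< : ∀ {r r′ q q′} → r ℕ.< n → q < q′ → + r + q * + n < + r′ + q′ * + n
  decompose-< {r} {r′} {q} {q′} r<n q<q′ = begin-strict
    + r + q * + n     <⟨ ℤₚ.+-monoˡ-< (q * + n) (+<+ r<n) ⟩
    + n + q * + n     ≡⟨ ℤₚ.+-comm (+ n) (q * + n) ⟩
    q * + n + + n     ≤⟨ *-suc-≤ q<q′ ⟩
    q′ * + n          ≤⟨ ℤₚ.i≤j+i (q′ * + n) (+ r′) ⟩
    + r′ + q′ * + n   ∎
    where open ℤₚ.≤-Reasoning

  decompose-injective : ∀ {r r′ q q′} → r ℕ.< n → r′ ℕ.< n →
                        + r + q * + n ≡ + r′ + q′ * + n → r ≡ r′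
  decompose-injective {q = q} {q′} r<n r′<n eq with ℤₚ.<-cmp q q′
  ... | tri< q<q′ _ _ = ⊥-elim (ℤₚ.<-irrefl eq (decompose-< r<n q<q′))
  ... | tri≈ _ refl _ = ℤₚ.+-injective (∙-cancelʳ (q * + n) _ _ eq)
  ... | tri> _ _ q′<q = ⊥-elim (ℤₚ.<-irrefl (sym eq) (decompose-< r′<n q′<q))

  %ℕ-decompose : ∀ {r} q → r ℕ.< n → (+ r + q * + n) %ℕ n ≡ r
  %ℕ-decompose {r} q r<n =
    decompose-injective {q = x /ℕ n} {q} (n%ℕd<d x n) r<n (sym (decompose x))
    where x = + r + q * + n

  %ℕ-+-* : ∀ x q → (x + q * + n) %ℕ n ≡ x %ℕ n
  %ℕ-+-* x q = begin
    (x + q * + n) %ℕ n                 ≡⟨ cong (λ y → (y + q * + n) %ℕ n) (decompose x) ⟩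
    (+ r + q′ * + n + q * + n) %ℕ n    ≡⟨ cong (_%ℕ n) (regroup (+ r) q′ q (+ n)) ⟩
    (+ r + (q′ + q) * + n) %ℕ n        ≡⟨ %ℕ-decompose (q′ + q) (n%ℕd<d x n) ⟩
    x %ℕ n                             ∎
    where
      open ≡-Reasoning
      r = x %ℕ n
      q′ = x /ℕ n
      regroup : ∀ r a b m → r + a * m + b * m ≡ r + (a + b) * m
      regroup = solve-∀

  %ℕ-+n : ∀ x → (x + + n) %ℕ n ≡ x %ℕ n
  %ℕ-+n x = trans (cong (λ y → (x + y) %ℕ n) (sym (ℤₚ.*-identityˡ (+ n)))) (%ℕ-+-* x 1ℤ)

  %ℕ-+ : ∀ x a → (x + a) %ℕ n ≡ (+ (x %ℕ n) + a) %ℕ n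
  %ℕ-+ x a = begin
    (x + a) %ℕ n                  ≡⟨ cong (λ y → (y + a) %ℕ n) (decompose x) ⟩
    (+ r + x /ℕ n * + n + a) %ℕ n ≡⟨ cong (_%ℕ n) (exchange (+ r) (x /ℕ n * + n) a) ⟩
    (+ r + a + x /ℕ n * + n) %ℕ n ≡⟨ %ℕ-+-* (+ r + a) (x /ℕ n) ⟩
    (+ r + a) %ℕ n                ∎
    where
      open ≡-Reasoning
      r = x %ℕ n
      exchange : ∀ r s a → r + s + a ≡ r + a + s
      exchange = solve-∀

  %ℕ-+-cong : ∀ {x y} a → x %ℕ n ≡ y %ℕ n → (x + a) %ℕ n ≡ (y + a) %ℕ n
  %ℕ-+-cong {x} {y} a eq =
    trans (%ℕ-+ x a) (trans (cong (λ r → (+ r + a) %ℕ n) eq) (sym (%ℕ-+ y a)))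

  %ℕ-≡⇒+n≤ : ∀ {x y} → x %ℕ n ≡ y %ℕ n → x < y → x + + n ≤ y
  %ℕ-≡⇒+n≤ {x} {y} eq x<y = begin
    x + + n                            ≡⟨ cong (_+ + n) (decompose x) ⟩
    + r + x /ℕ n * + n + + n           ≡⟨ ℤₚ.+-assoc (+ r) (x /ℕ n * + n) (+ n) ⟩
    + r + (x /ℕ n * + n + + n)         ≤⟨ ℤₚ.+-monoʳ-≤ (+ r) (*-suc-≤ quotient-<) ⟩
    + r + y /ℕ n * + n                 ≡⟨ cong (λ s → + s + y /ℕ n * + n) eq ⟩
    + (y %ℕ n) + y /ℕ n * + n          ≡⟨ decompose y ⟨
    y                                  ∎
    where
      open ℤₚ.≤-Reasoning
      r = x %ℕ n
      quotient-< : x /ℕ n < y /ℕ n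
      quotient-< = ℤₚ.≰⇒> λ qy≤qx → ℤₚ.<⇒≱ x<y (begin
        y                         ≡⟨ decompose y ⟩
        + (y %ℕ n) + y /ℕ n * + n ≡⟨ cong (λ s → + s + y /ℕ n * + n) eq ⟨
        + r + y /ℕ n * + n        ≤⟨ ℤₚ.+-monoʳ-≤ (+ r) (ℤₚ.*-monoʳ-≤-nonNeg (+ n) qy≤qx) ⟩
        + r + x /ℕ n * + n        ≡⟨ decompose x ⟨
        x                         ∎)

  %ℕ-injective-window : ∀ {d x y} → InWindow n d x → InWindow n d y → x %ℕ n ≡ y %ℕ n → x ≡ y
  %ℕ-injective-window {x = x} {y} x∈ y∈ eq with ℤₚ.<-cmp x y
  ... | tri< x<y _ _ = ⊥-elim (window-+n≰ x∈ y∈ (%ℕ-≡⇒+n≤ eq x<y))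
  ... | tri≈ _ x≡y _ = x≡y
  ... | tri> _ _ y<x = ⊥-elim (window-+n≰ y∈ x∈ (%ℕ-≡⇒+n≤ (sym eq) y<x))

  periodic-agree : ∀ {d f g} → Periodic n f → Periodic n g →
                   (∀ x → InWindow n d x → f x ≡ g x) → ∀ x → f x ≡ g x
  periodic-agree {d} {f} {g} f-per g-per agree x = begin
    f x                   ≡⟨ cong f x≡b+q*n ⟩
    f (b + q * + n)       ≡⟨ periodic-* {n} {f} f-per q b ⟩
    f b + q * + n         ≡⟨ cong (_+ q * + n) (agree b b∈) ⟩
    g b + q * + n         ≡⟨ periodic-* {n} {g} g-per q b ⟨
    g (b + q * + n)       ≡⟨ cong g x≡b+q*n ⟨
    g x                   ∎
    where
      open ≡-Reasoning
      r = (x - d) %ℕ n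
      q = (x - d) /ℕ n
      b = d + + r
      b∈ : InWindow n d b
      b∈ = ℤₚ.i≤i+j d (+ r) , ℤₚ.+-monoʳ-< d (+<+ (n%ℕd<d (x - d) n))
      x≡b+q*n : x ≡ b + q * + n
      x≡b+q*n = begin
        x                    ≡⟨ add-diff x d ⟨
        d + (x - d)          ≡⟨ cong (_+_ d) (decompose (x - d)) ⟩
        d + (+ r + q * + n)  ≡⟨ ℤₚ.+-assoc d (+ r) (q * + n) ⟨
        b + q * + n          ∎
        where
          add-diff : ∀ x d → d + (x - d) ≡ x
          add-diff = solve-∀

module Generators (n : ℕ) .{{_ : NonZero n}} (2≤n : 2 ℕ.≤ n) where

  open Residues n

  %ℕ-suc≢ : ∀ x → (x + 1ℤ) %ℕ n ≢ x %ℕ n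
  %ℕ-suc≢ x eq = ℤₚ.<⇒≱ (+<+ 2≤n) (+-cancelˡ-≤ x (%ℕ-≡⇒+n≤ (sym eq) (i<i+1 x)))

  data GenCase (i : Fin n) (x : ℤ) : Set where
    lower : x %ℕ n ≡ toℕ i → GenCase i x
    upper : x %ℕ n ≢ toℕ i → x %ℕ n ≡ (toℕ i ℕ.+ 1) ℕ.% n → GenCase i x
    other : x %ℕ n ≢ toℕ i → x %ℕ n ≢ (toℕ i ℕ.+ 1) ℕ.% n → GenCase i x

  genCase : ∀ i x → GenCase i x
  genCase i x with x %ℕ n ℕ.≟ toℕ i
  ... | yes p = lower p
  ... | no ¬p with x %ℕ n ℕ.≟ (toℕ i ℕ.+ 1) ℕ.% n
  ...   | yes q = upper ¬p q
  ...   | no ¬q = other ¬p ¬q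

  gen-lower : ∀ i x → x %ℕ n ≡ toℕ i → gen n i x ≡ x + 1ℤ
  gen-lower i x p with x %ℕ n ℕ.≟ toℕ i
  ... | yes _ = refl
  ... | no ¬p = ⊥-elim (¬p p)

  gen-upper : ∀ i x → x %ℕ n ≢ toℕ i → x %ℕ n ≡ (toℕ i ℕ.+ 1) ℕ.% n → gen n i x ≡ x - 1ℤ
  gen-upper i x ¬p q with x %ℕ n ℕ.≟ toℕ i
  ... | yes p = ⊥-elim (¬p p)
  ... | no _ with x %ℕ n ℕ.≟ (toℕ i ℕ.+ 1) ℕ.% n
  ...   | yes _ = refl
  ...   | no ¬q = ⊥-elim (¬q q)

  gen-other : ∀ i x → x %ℕ n ≢ toℕ i → x %ℕ n ≢ (toℕ i ℕ.+ 1) ℕ.% n → gen n i x ≡ x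
  gen-other i x ¬p ¬q with x %ℕ n ℕ.≟ toℕ i
  ... | yes p = ⊥-elim (¬p p)
  ... | no _ with x %ℕ n ℕ.≟ (toℕ i ℕ.+ 1) ℕ.% n
  ...   | yes q = ⊥-elim (¬q q)
  ...   | no _ = refl

  %ℕ-suc-class : ∀ {i} y → y %ℕ n ≡ toℕ i → (y + 1ℤ) %ℕ n ≡ (toℕ i ℕ.+ 1) ℕ.% n
  %ℕ-suc-class {i} y eq = %ℕ-+-cong {y} {+ toℕ i} 1ℤ (trans eq (sym (ℕ.m<n⇒m%n≡m (Finₚ.toℕ<n i))))

  %ℕ-pred-class : ∀ {i} x → x %ℕ n ≡ (toℕ i ℕ.+ 1) ℕ.% n → (x - 1ℤ) %ℕ n ≡ toℕ i
  %ℕ-pred-class {i} x eq = trans (%ℕ-+-cong {x} {+ toℕ i + 1ℤ} -1ℤ eq)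
    (trans (cong (_%ℕ n) (+1-1 (+ toℕ i))) (ℕ.m<n⇒m%n≡m (Finₚ.toℕ<n i)))

  gen-lower-suc : ∀ {i} y → y %ℕ n ≡ toℕ i → gen n i (y + 1ℤ) ≡ y
  gen-lower-suc {i} y eq = trans
    (gen-upper i (y + 1ℤ) (λ eq′ → %ℕ-suc≢ y (trans eq′ (sym eq))) (%ℕ-suc-class y eq))
    (+1-1 y)

  gen-fixes-window : ∀ {i d} x y → y %ℕ n ≡ toℕ i →
                     InWindow n d x → InWindow n d y → InWindow n d (y + 1ℤ) →
                     x ≢ y → x ≢ y + 1ℤ → gen n i x ≡ x
  gen-fixes-window x y eq x∈ y∈ y+1∈ x≢y x≢y+1 = gen-other _ _
    (λ eq′ → x≢y (%ℕ-injective-window x∈ y∈ (trans eq′ (sym eq))))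
    (λ eq′ → x≢y+1 (%ℕ-injective-window x∈ y+1∈ (trans eq′ (sym (%ℕ-suc-class y eq)))))

  gen-involutive : ∀ i x → gen n i (gen n i x) ≡ x
  gen-involutive i x with genCase i x
  ... | lower p = trans (cong (gen n i) (gen-lower i x p)) (gen-lower-suc x p)
  ... | upper ¬p q = begin
    gen n i (gen n i x)           ≡⟨ cong (gen n i) (gen-upper i x ¬p q) ⟩
    gen n i (x - 1ℤ)              ≡⟨ gen-lower _ (x - 1ℤ) (%ℕ-pred-class x q) ⟩
    x - 1ℤ + 1ℤ                   ≡⟨ -1+1 x ⟩
    x                             ∎
    where open ≡-Reasoning
  ... | other ¬p ¬q = trans (cong (gen n i) (gen-other i x ¬p ¬q)) (gen-other i x ¬p ¬q)

  gen-periodic : ∀ i → Periodic n (gen n i)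
  gen-periodic i x with genCase i x | %ℕ-+n x
  ... | lower p     | same = trans (gen-lower i (x + + n) (trans same p))
    (trans (swap-+ x (+ n) 1ℤ) (cong (_+ + n) (sym (gen-lower i x p))))
  ... | upper ¬p q  | same = trans (gen-upper i (x + + n) (¬p ∘ trans (sym same)) (trans same q))
    (trans (swap-+ x (+ n) -1ℤ) (cong (_+ + n) (sym (gen-upper i x ¬p q))))
  ... | other ¬p ¬q | same = trans (gen-other i (x + + n) (¬p ∘ trans (sym same)) (¬q ∘ trans (sym same)))
    (cong (_+ + n) (sym (gen-other i x ¬p ¬q)))

  evalWord-++ : ∀ ws vs x → evalWord n (ws ++ vs) x ≡ evalWord n ws (evalWord n vs x)
  evalWord-++ []       vs x = refl
  evalWord-++ (j ∷ ws) vs x = cong (gen n j) (evalWord-++ ws vs x)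

  classOf : ℤ → Fin n
  classOf y = fromℕ< (n%ℕd<d y n)

  %ℕ-classOf : ∀ y → y %ℕ n ≡ toℕ (classOf y)
  %ℕ-classOf y = sym (Finₚ.toℕ-fromℕ< (n%ℕd<d y n))

  -- cycle y l = s_{y+l-1} ∘ ⋯ ∘ s_y sends y to y + l and shifts y+1, …, y+l down by one.
  cycle : ℤ → ℕ → ℤ → ℤ
  cycle y zero    = id
  cycle y (suc l) = cycle (y + 1ℤ) l ∘ gen n (classOf y)

  cycleWord : ℤ → ℕ → List (Fin n)
  cycleWord y zero    = []
  cycleWord y (suc l) = classOf y ∷ cycleWord (y + 1ℤ) l

  +1-+ : ∀ y l → y + 1ℤ + + l ≡ y + + suc l
  +1-+ y l = ℤₚ.+-assoc y 1ℤ (+ l)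

  evalWord-cycleWord : ∀ y l x → evalWord n (cycleWord y l) (cycle y l x) ≡ x
  evalWord-cycleWord y zero    x = refl
  evalWord-cycleWord y (suc l) x =
    trans (cong (gen n (classOf y)) (evalWord-cycleWord (y + 1ℤ) l (gen n (classOf y) x)))
          (gen-involutive (classOf y) x)

  cycle-injective : ∀ y l → Injective _≡_ _≡_ (cycle y l)
  cycle-injective y l {a} {b} eq = begin
    a                                          ≡⟨ evalWord-cycleWord y l a ⟨
    evalWord n (cycleWord y l) (cycle y l a)   ≡⟨ cong (evalWord n (cycleWord y l)) eq ⟩
    evalWord n (cycleWord y l) (cycle y l b)   ≡⟨ evalWord-cycleWord y l b ⟩
    b                                          ∎
    where open ≡-Reasoning

  cycle-periodic : ∀ y l → Periodic n (cycle y l)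
  cycle-periodic y zero    x = refl
  cycle-periodic y (suc l) = periodic-∘ {n} {cycle (y + 1ℤ) l} {gen n (classOf y)}
    (cycle-periodic (y + 1ℤ) l) (gen-periodic (classOf y))

  cycle-start : ∀ y l → cycle y l y ≡ y + + l
  cycle-start y zero    = sym (ℤₚ.+-identityʳ y)
  cycle-start y (suc l) = begin
    cycle (y + 1ℤ) l (gen n (classOf y) y)   ≡⟨ cong (cycle (y + 1ℤ) l) (gen-lower _ y (%ℕ-classOf y)) ⟩
    cycle (y + 1ℤ) l (y + 1ℤ)                ≡⟨ cycle-start (y + 1ℤ) l ⟩
    y + 1ℤ + + l                             ≡⟨ +1-+ y l ⟩
    y + + suc l                              ∎
    where open ≡-Reasoning

  start∈window : ∀ d → InWindow n d d
  start∈window d = ℤₚ.≤-refl ,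
    subst (_< d + + n) (ℤₚ.+-identityʳ d) (ℤₚ.+-monoʳ-< d (+<+ (ℕₚ.<-≤-trans (s≤s z≤n) 2≤n)))

  module _ {d : ℤ} where

    gen-classOf-window : ∀ y → InWindow n d y → InWindow n d (y + 1ℤ) →
                         ∀ x → InWindow n d x → InWindow n d (gen n (classOf y) x)
    gen-classOf-window y y∈ y+1∈ x x∈ with x ℤ.≟ y | x ℤ.≟ y + 1ℤ
    ... | yes refl | _        = subst (InWindow n d) (sym (gen-lower _ y (%ℕ-classOf y))) y+1∈
    ... | no _     | yes refl = subst (InWindow n d) (sym (gen-lower-suc y (%ℕ-classOf y))) y∈
    ... | no x≢y   | no x≢y+1 = subst (InWindow n d)
      (sym (gen-fixes-window x y (%ℕ-classOf y) x∈ y∈ y+1∈ x≢y x≢y+1)) x∈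

    cycle-window : ∀ y l → d ≤ y → y + + l < d + + n →
                   ∀ x → InWindow n d x → InWindow n d (cycle y l x)
    cycle-window y zero    d≤y _ x x∈ = x∈
    cycle-window y (suc l) d≤y y+l<d+n x x∈ =
      cycle-window (y + 1ℤ) l d≤y+1 (subst (_< d + + n) (sym (+1-+ y l)) y+l<d+n)
        (gen n (classOf y) x) (gen-classOf-window y y∈ y+1∈ x x∈)
      where
        d≤y+1 = i≤j⇒i≤j+1 d≤y
        y∈ = d≤y , ℤₚ.≤-<-trans (ℤₚ.i≤i+j y (+ suc l)) y+l<d+n
        y+1∈ = d≤y+1 , ℤₚ.≤-<-trans (i+1≤i+suc y l) y+l<d+n

    cycle-fixes : ∀ y l x → d ≤ y → y + + l < x → x < d + + n → cycle y l x ≡ x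
    cycle-fixes y zero    x _   _       _     = refl
    cycle-fixes y (suc l) x d≤y y+l<x x<d+n = begin
      cycle (y + 1ℤ) l (gen n (classOf y) x)   ≡⟨ cong (cycle (y + 1ℤ) l) fixed ⟩
      cycle (y + 1ℤ) l x                       ≡⟨ cycle-fixes (y + 1ℤ) l x d≤y+1 y+1+l<x x<d+n ⟩
      x                                        ∎
      where
        open ≡-Reasoning
        d≤y+1 = i≤j⇒i≤j+1 d≤y
        y+1+l<x = subst (_< x) (sym (+1-+ y l)) y+l<x
        y+1<x : y + 1ℤ < x
        y+1<x = ℤₚ.≤-<-trans (i+1≤i+suc y l) y+l<x
        y<x = ℤₚ.<-trans (i<i+1 y) y+1<x
        fixed = gen-fixes-window x y (%ℕ-classOf y)
          (ℤₚ.≤-trans d≤y (ℤₚ.<⇒≤ y<x) , x<d+n)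
          (d≤y , ℤₚ.<-trans y<x x<d+n)
          (d≤y+1 , ℤₚ.<-trans y+1<x x<d+n)
          (λ x≡y → ℤₚ.<-irrefl (sym x≡y) y<x) (λ x≡y+1 → ℤₚ.<-irrefl (sym x≡y+1) y+1<x)

    -- s_{d-1} is the only generator exchanging an element of the window with one outside it.
    cycleWord-avoids : ∀ y l → d ≤ y → y + + l < d + + n →
                       All (_∈ ∁ ⁅ classOf (d - 1ℤ) ⁆) (cycleWord y l)
    cycleWord-avoids y zero    _   _       = []
    cycleWord-avoids y (suc l) d≤y y+l<d+n =
      Subsetₚ.x∉p⇒x∈∁p (classOf-y≢ ∘ Subsetₚ.x∈⁅y⁆⇒x≡y _) ∷
      cycleWord-avoids (y + 1ℤ) l d≤y+1 (subst (_< d + + n) (sym (+1-+ y l)) y+l<d+n)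
      where
        d≤y+1 = i≤j⇒i≤j+1 d≤y
        classOf-y≢ : classOf y ≢ classOf (d - 1ℤ)
        classOf-y≢ eq = ℤₚ.<-irrefl (sym y+1≡d) (ℤₚ.≤-<-trans d≤y (i<i+1 y))
          where
            same : (y + 1ℤ) %ℕ n ≡ d %ℕ n
            same = trans (%ℕ-+-cong {y} {d - 1ℤ} 1ℤ
                     (trans (%ℕ-classOf y) (trans (cong toℕ eq) (sym (%ℕ-classOf (d - 1ℤ))))))
                     (cong (_%ℕ n) (-1+1 d))
            y+1≡d : y + 1ℤ ≡ d
            y+1≡d = %ℕ-injective-window
              (d≤y+1 , ℤₚ.≤-<-trans (i+1≤i+suc y l) y+l<d+n)
              (start∈window d) same

    WindowPreserving : (ℤ → ℤ) → Set
    WindowPreserving f = ∀ x → InWindow n d x → InWindow n d (f x)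

    -- Selection sort from the top of the window: composing with the cycle that carries
    -- v = f p up to p (v ≤ p by injectivity) fixes p and keeps the points above p fixed.
    window-preserving-fixing⇒parabolic :
      ∀ k → k ℕ.≤ n → ∀ f → Periodic n f → Injective _≡_ _≡_ f → WindowPreserving f →
      (∀ x → d + + k ≤ x → x < d + + n → f x ≡ x) →
      InParabolic n (∁ ⁅ classOf (d - 1ℤ) ⁆) f
    window-preserving-fixing⇒parabolic zero _ f f-per _ _ f-fixes =
      [] , [] , periodic-agree {d} {f} {id} f-per (λ _ → refl)
        (λ x (d≤x , x<d+n) → f-fixes x (subst (_≤ x) (sym (ℤₚ.+-identityʳ d)) d≤x) x<d+n)
    window-preserving-fixing⇒parabolic (suc k) k<n f f-per f-inj f-window f-fixes =
      cycleWord v l ++ ws ,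
      Allₚ.++⁺ (cycleWord-avoids v l (proj₁ v∈) v+l<d+n) ws∈ ,
      λ x → begin
        f x                                                ≡⟨ evalWord-cycleWord v l (f x) ⟨
        evalWord n (cycleWord v l) (g x)                   ≡⟨ cong (evalWord n (cycleWord v l)) (g≗ws x) ⟩
        evalWord n (cycleWord v l) (evalWord n ws x)       ≡⟨ evalWord-++ (cycleWord v l) ws x ⟨
        evalWord n (cycleWord v l ++ ws) x                 ∎
      where
        open ≡-Reasoning
        p = d + + k
        p∈ : InWindow n d p
        p∈ = ℤₚ.i≤i+j d (+ k) , ℤₚ.+-monoʳ-< d (+<+ k<n)
        above-p : ∀ {x} → p < x → d + + suc k ≤ x
        above-p {x} p<x = subst (_≤ x) (shuffle d (+ k)) (ℤₚ.i<j⇒suc[i]≤j p<x)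
          where
            shuffle : ∀ d k → 1ℤ + (d + k) ≡ d + (1ℤ + k)
            shuffle = solve-∀
        v = f p
        v∈ = f-window p p∈
        v≤p : v ≤ p
        v≤p = ℤₚ.≮⇒≥ λ p<v → ℤₚ.<-irrefl (sym (f-inj (f-fixes v (above-p p<v) (proj₂ v∈)))) p<v
        l = proj₁ (≤⇒≡+ v≤p)
        p≡v+l : p ≡ v + + l
        p≡v+l = proj₂ (≤⇒≡+ v≤p)
        v+l<d+n : v + + l < d + + n
        v+l<d+n = subst (_< d + + n) p≡v+l (proj₂ p∈)
        g = cycle v l ∘ f
        g-fixes : ∀ x → p ≤ x → x < d + + n → g x ≡ x
        g-fixes x p≤x x<d+n with x ℤ.≟ p
        ... | yes refl = trans (cycle-start v l) (sym p≡v+l)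
        ... | no x≢p = trans (cong (cycle v l) (f-fixes x (above-p p<x) x<d+n))
                             (cycle-fixes v l x (proj₁ v∈) (subst (_< x) p≡v+l p<x) x<d+n)
          where p<x = ℤₚ.≤∧≢⇒< p≤x (x≢p ∘ sym)
        sorted = window-preserving-fixing⇒parabolic k (ℕₚ.<⇒≤ k<n) g
          (periodic-∘ {n} {cycle v l} {f} (cycle-periodic v l) f-per)
          (f-inj ∘ cycle-injective v l)
          (λ x x∈ → cycle-window v l (proj₁ v∈) v+l<d+n (f x) (f-window x x∈))
          g-fixes
        ws = proj₁ sorted
        ws∈ = proj₁ (proj₂ sorted)
        g≗ws = proj₂ (proj₂ sorted)

    window-preserving⇒parabolic : ∀ f → Periodic n f → Injective _≡_ _≡_ f → WindowPreserving f →
                                  InParabolic n (∁ ⁅ classOf (d - 1ℤ) ⁆) f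
    window-preserving⇒parabolic f f-per f-inj f-window =
      window-preserving-fixing⇒parabolic n ℕₚ.≤-refl f f-per f-inj f-window
        (λ x d+n≤x x<d+n → ⊥-elim (ℤₚ.<-irrefl refl (ℤₚ.<-≤-trans x<d+n d+n≤x)))

  windowSum-∘gen-interior : ∀ h → Periodic n h → ∀ i j → toℕ i ≡ suc j →
                            windowSum (h ∘ gen n i) n ≡ windowSum h n
  windowSum-∘gen-interior h h-per i j i≡1+j = begin
    windowSum (h ∘ gen n i) n  ≡⟨ windowSum-sumUpTo (h ∘ gen n i) n ⟩
    sumUpTo G n                ≡⟨ sumUpTo-exchange n j (suc j) (ℕₚ.n<1+n j) 1+j<n fixed swapped ⟩
    sumUpTo F n                ≡⟨ windowSum-sumUpTo h n ⟨
    windowSum h n              ∎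
    where
      open ≡-Reasoning
      F G : ℕ → ℤ
      F k = h (+ suc k)
      G k = h (gen n i (+ suc k))
      1+j<n : suc j ℕ.< n
      1+j<n = subst (ℕ._< n) i≡1+j (Finₚ.toℕ<n i)
      y = + suc j
      y%n : y %ℕ n ≡ toℕ i
      y%n = trans (ℕ.m<n⇒m%n≡m 1+j<n) (sym i≡1+j)
      y+1≡ : y + 1ℤ ≡ + suc (suc j)
      y+1≡ = cong +_ (ℕₚ.+-comm (suc j) 1)
      swapped : G j + G (suc j) ≡ F j + F (suc j)
      swapped = trans
        (cong₂ _+_ (cong h (trans (gen-lower _ y y%n) y+1≡))
                   (cong h (trans (cong (gen n i) (sym y+1≡)) (gen-lower-suc y y%n))))
        (ℤₚ.+-comm (F (suc j)) (F j))
      in-window : ∀ {m} → m ℕ.< n → InWindow n 1ℤ (+ suc m)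
      in-window m<n = +≤+ (s≤s z≤n) , +<+ (s≤s m<n)
      fixed : ∀ k → k ℕ.< n → k ≢ j → k ≢ suc j → G k ≡ F k
      fixed k k<n k≢j k≢1+j = cong h (gen-fixes-window (+ suc k) y y%n
        (in-window k<n) (in-window (ℕₚ.<-trans (ℕₚ.n<1+n j) 1+j<n))
        (subst (InWindow n 1ℤ) (sym y+1≡) (in-window 1+j<n))
        (k≢j ∘ ℕₚ.suc-injective ∘ ℤₚ.+-injective)
        (λ eq → k≢1+j (ℕₚ.suc-injective (ℤₚ.+-injective (trans eq y+1≡)))))

  -- s_0 exchanges 0 ↔ 1 and n ↔ n + 1, so on the window 1, …, n it trades
  -- h(1), h(n) for h(0) = h(n) - n and h(n + 1) = h(1) + n.
  windowSum-∘gen-boundary : ∀ h → Periodic n h → ∀ i → toℕ i ≡ 0 →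
                            windowSum (h ∘ gen n i) n ≡ windowSum h n
  windowSum-∘gen-boundary h h-per i i≡0 = begin
    windowSum (h ∘ gen n i) n  ≡⟨ windowSum-sumUpTo (h ∘ gen n i) n ⟩
    sumUpTo G n                ≡⟨ sumUpTo-exchange n 0 (ℕ.pred n) 0<n-1 n-1<n fixed swapped ⟩
    sumUpTo F n                ≡⟨ windowSum-sumUpTo h n ⟨
    windowSum h n              ∎
    where
      open ≡-Reasoning
      F G : ℕ → ℤ
      F k = h (+ suc k)
      G k = h (gen n i (+ suc k))
      1+[n-1]≡n : suc (ℕ.pred n) ≡ n
      1+[n-1]≡n = ℕₚ.suc-pred n
      0<n-1 : 0 ℕ.< ℕ.pred n
      0<n-1 = ℕₚ.<-≤-trans (s≤s z≤n) (ℕₚ.pred-mono-≤ 2≤n)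
      n-1<n : ℕ.pred n ℕ.< n
      n-1<n = ℕₚ.≤-reflexive 1+[n-1]≡n
      0%n : 0ℤ %ℕ n ≡ toℕ i
      0%n = trans (ℕ.m<n⇒m%n≡m (ℕₚ.<-trans 0<n-1 n-1<n)) (sym i≡0)
      G-last : G (ℕ.pred n) ≡ F 0 + + n
      G-last = begin
        h (gen n i (+ suc (ℕ.pred n)))  ≡⟨ cong (λ m → h (gen n i (+ m))) 1+[n-1]≡n ⟩
        h (gen n i (0ℤ + + n))          ≡⟨ cong h (gen-periodic i 0ℤ) ⟩
        h (gen n i 0ℤ + + n)            ≡⟨ h-per (gen n i 0ℤ) ⟩
        h (gen n i 0ℤ) + + n            ≡⟨ cong (λ z → h z + + n) (gen-lower _ 0ℤ 0%n) ⟩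
        F 0 + + n                       ∎
      F-last : F (ℕ.pred n) ≡ h 0ℤ + + n
      F-last = trans (cong (λ m → h (+ m)) 1+[n-1]≡n) (h-per 0ℤ)
      swapped : G 0 + G (ℕ.pred n) ≡ F 0 + F (ℕ.pred n)
      swapped = begin
        G 0 + G (ℕ.pred n)     ≡⟨ cong₂ _+_ (cong h (gen-lower-suc 0ℤ 0%n)) G-last ⟩
        h 0ℤ + (F 0 + + n)     ≡⟨ exchange (h 0ℤ) (F 0) (+ n) ⟩
        F 0 + (h 0ℤ + + n)     ≡⟨ cong (_+_ (F 0)) F-last ⟨
        F 0 + F (ℕ.pred n)     ∎
        where
          exchange : ∀ a b c → a + (b + c) ≡ b + (a + c)
          exchange = solve-∀
      in-window : ∀ {m} → m ℕ.< n → InWindow n 0ℤ (+ m)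
      in-window m<n = +≤+ z≤n , +<+ m<n
      fixed : ∀ k → k ℕ.< n → k ≢ 0 → k ≢ ℕ.pred n → G k ≡ F k
      fixed k k<n k≢0 k≢n-1 = cong h (gen-fixes-window (+ suc k) 0ℤ 0%n
        (in-window (ℕₚ.≤∧≢⇒< k<n λ 1+k≡n →
          k≢n-1 (ℕₚ.suc-injective (trans 1+k≡n (sym 1+[n-1]≡n)))))
        (in-window (ℕₚ.<-trans 0<n-1 n-1<n)) (in-window (ℕₚ.<-≤-trans (s≤s 0<n-1) n-1<n))
        (λ ()) (λ eq → k≢0 (ℕₚ.suc-injective (ℤₚ.+-injective eq))))

  windowSum-∘gen : ∀ h → Periodic n h → ∀ i → windowSum (h ∘ gen n i) n ≡ windowSum h n
  windowSum-∘gen h h-per i = by-cases (toℕ i) refl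
    where
      by-cases : ∀ m → toℕ i ≡ m → windowSum (h ∘ gen n i) n ≡ windowSum h n
      by-cases zero    i≡0   = windowSum-∘gen-boundary h h-per i i≡0
      by-cases (suc j) i≡1+j = windowSum-∘gen-interior h h-per i j i≡1+j

  windowSum-∘evalWord : ∀ h → Periodic n h → ∀ ws → windowSum (h ∘ evalWord n ws) n ≡ windowSum h n
  windowSum-∘evalWord h h-per []       = refl
  windowSum-∘evalWord h h-per (j ∷ ws) = trans
    (windowSum-∘evalWord (h ∘ gen n j) (periodic-∘ {n} {h} {gen n j} h-per (gen-periodic j)) ws)
    (windowSum-∘gen h h-per j)

  window-translation : ∀ {d L f} → Periodic n f → Injective _≡_ _≡_ f →
                       (∀ x → InWindow n d x → InWindow n L (f x)) →
                       windowSum f n ≡ windowSum id n → L ≡ d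
  window-translation {d} {L} {f} f-per f-inj f-window sum≡ =
    sym (ℤₚ.i-j≡0⇒i≡j d L (ℤₚ.*-cancelˡ-≡ (+ n) δ 0ℤ (∙-cancelˡ (windowSum f n) _ _ sums)))
    where
      open ≡-Reasoning
      δ = d - L
      h : ℤ → ℤ
      h x = f x + δ
      h-per : Periodic n h
      h-per x = trans (cong (_+ δ) (f-per x)) (swap-+ (f x) (+ n) δ)
      h-window : WindowPreserving {d} h
      h-window x x∈ = let (L≤fx , fx<L+n) = f-window x x∈ in
        subst (_≤ h x) (shift L d) (ℤₚ.+-monoˡ-≤ δ L≤fx) ,
        subst (h x <_) (shift+ L (+ n) d) (ℤₚ.+-monoˡ-< δ fx<L+n)
        where
          shift : ∀ L d → L + (d - L) ≡ d
          shift = solve-∀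
          shift+ : ∀ L m d → L + m + (d - L) ≡ d + m
          shift+ = solve-∀
      parabolic = window-preserving⇒parabolic {d} h h-per (f-inj ∘ ∙-cancelʳ δ _ _) h-window
      ws = proj₁ parabolic
      h≗ws = proj₂ (proj₂ parabolic)
      sums : windowSum f n + + n * δ ≡ windowSum f n + + n * 0ℤ
      sums = begin
        windowSum f n + + n * δ          ≡⟨ windowSum-+const f δ n ⟨
        windowSum h n                    ≡⟨ windowSum-cong n h≗ws ⟩
        windowSum (evalWord n ws) n      ≡⟨ windowSum-∘evalWord id (λ _ → refl) ws ⟩
        windowSum id n                   ≡⟨ sum≡ ⟨
        windowSum f n                    ≡⟨ ℤₚ.+-identityʳ _ ⟨
        windowSum f n + 0ℤ               ≡⟨ cong (_+_ (windowSum f n)) (ℤₚ.*-zeroʳ (+ n)) ⟨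
        windowSum f n + + n * 0ℤ         ∎

  window-preserving⇒InProperParabolic : ∀ {d f} → Periodic n f → Injective _≡_ _≡_ f →
                                        WindowPreserving {d} f → InProperParabolic n f
  window-preserving⇒InProperParabolic {d} {f} f-per f-inj f-window =
    ∁ ⁅ j ⁆ , (j , λ j∈∁ → Subsetₚ.x∈∁p⇒x∉p j∈∁ (Subsetₚ.x∈⁅x⁆ j)) ,
    window-preserving⇒parabolic {d} f f-per f-inj f-window
    where j = classOf (d - 1ℤ)

≥-rec : ∀ {ℓ} β (P : ℤ → Set ℓ) →
        (∀ x → β ≤ x → (∀ e → β ≤ e → e < x → P e) → P x) → ∀ x → β ≤ x → P x
≥-rec {ℓ} β P step = All.wfRec (On.wellFounded distance <-wellFounded) ℓ (λ x → β ≤ x → P x)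
  (λ x rec β≤x → step x β≤x (λ e β≤e e<x → rec (distance-< β≤e e<x) β≤e))
  where
    distance : ℤ → ℕ
    distance x = ∣ x - β ∣
    distance-< : ∀ {e x} → β ≤ e → e < x → distance e ℕ.< distance x
    distance-< {e} {x} β≤e e<x = ℤₚ.drop‿+<+ (subst₂ _<_
      (sym (ℤₚ.0≤i⇒+∣i∣≡i (ℤₚ.i≤j⇒0≤j-i β≤e)))
      (sym (ℤₚ.0≤i⇒+∣i∣≡i (ℤₚ.i≤j⇒0≤j-i (ℤₚ.<⇒≤ (ℤₚ.≤-<-trans β≤e e<x)))))
      (ℤₚ.+-monoˡ-< (- β) e<x))

-- Any x in (c, d) with w x > w c would be a left-to-right maximum between c and d.
below-next-max-from : ∀ {n w β c d} → ConsecLRMax n w β c d → ∀ x → β ≤ x → x < d → w x ≤ w c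
below-next-max-from {n} {w} {β} {c} {d} ((_ , _ , c-max) , (_ , d<β+n , _) , _ , between) =
  ≥-rec β (λ x → x < d → w x ≤ w c) step
  where
    step : ∀ x → β ≤ x → (∀ e → β ≤ e → e < x → e < d → w e ≤ w c) → x < d → w x ≤ w c
    step x β≤x below x<d with ℤₚ.<-cmp x c
    ... | tri< x<c _ _ = ℤₚ.<⇒≤ (c-max x β≤x x<c)
    ... | tri≈ _ refl _ = ℤₚ.≤-refl
    ... | tri> _ _ c<x = ℤₚ.≮⇒≥ λ wc<wx → between x c<x x<d
      (β≤x , ℤₚ.<-trans x<d d<β+n ,
       λ e β≤e e<x → ℤₚ.≤-<-trans (below e β≤e e<x (ℤₚ.<-trans e<x x<d)) wc<wx)

below-next-max : ∀ {n w β c d} → (∀ i → i < β → w i < w β) → ConsecLRMax n w β c d →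
                 ∀ x → x < d → w x ≤ w c
below-next-max {β = β} β-max consec@((β≤c , _) , _ , c<d , _) x x<d with x ℤ.<? β
... | yes x<β = ℤₚ.<⇒≤ (ℤₚ.<-≤-trans (β-max x x<β)
                  (below-next-max-from consec β ℤₚ.≤-refl (ℤₚ.≤-<-trans β≤c c<d)))
... | no x≮β = below-next-max-from consec x (ℤₚ.≮⇒≥ x≮β) x<d

window-image : ∀ {n w c d} → Periodic n w → (∀ x → x < d → w x ≤ w c) →
               (∀ b → d ≤ b → b < d + + n → w b > w c) →
               ∀ x → InWindow n d x → InWindow n (1ℤ + w c) (w x)
window-image {n} {w} {c} {d} w-per below above x (d≤x , x<d+n) =
  ℤₚ.i<j⇒suc[i]≤j (above x d≤x x<d+n) , (begin-strict
    w x                    ≡⟨ cong w (sub-add x (+ n)) ⟨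
    w (x - + n + + n)      ≡⟨ w-per (x - + n) ⟩
    w (x - + n) + + n      ≤⟨ ℤₚ.+-monoˡ-≤ (+ n) (below (x - + n) x-n<d) ⟩
    w c + + n              <⟨ ℤₚ.+-monoˡ-< (+ n) (subst (w c <_) (ℤₚ.+-comm (w c) 1ℤ) (i<i+1 (w c))) ⟩
    1ℤ + w c + + n         ∎)
  where
    open ℤₚ.≤-Reasoning
    sub-add : ∀ x m → x - m + m ≡ x
    sub-add = solve-∀
    add-sub : ∀ x m → x + m - m ≡ x
    add-sub = solve-∀
    x-n<d : x - + n < d
    x-n<d = subst (x - + n <_) (add-sub d (+ n)) (ℤₚ.+-monoˡ-< (- + n) x<d+n)

lemma4p2 : (n : ℕ) .{{_ : NonZero n}} → 2 ℕ.≤ n →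
    (w : ℤ → ℤ) → IsAffinePerm n w →
    (β : ℤ) → (∀ i → i < β → w i < w β) →
    (Σ ℤ λ c → Σ ℤ λ d → ConsecLRMax n w β c d ×
       (∀ b → d ≤ b → b < d + + n → w b > w c)) →
    InProperParabolic n w
lemma4p2 n 2≤n w aff β β-max (c , d , consec , above) =
  window-preserving⇒InProperParabolic {d} periodic injective
    (subst (λ L → ∀ x → InWindow n d x → InWindow n L (w x)) L≡d w-window)
  where
    open IsAffinePerm aff
    open Generators n 2≤n
    injective = proj₁ bijective
    w-window = window-image periodic (below-next-max β-max consec) above
    L≡d = window-translation periodic injective w-window (trans windowSum≡ (sym (windowSum-id n)))
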